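{- $\mathrm{ex}(n,\{\text{ears},\text{bat},\text{mariposa}\})\in\Omega(n^3)$ as $n\to\infty$.
   Context: Let $P$ be a set of $n$ points in convex position in the plane (the vertices of a convex $n$-gon); a triangle on $P$ is a 3-element subset of $P$. For two distinct triangles $t_1,t_2$ on $P$, label each point of $t_1\cup t_2$ by the triangle(s) containing it and read the points in their cyclic order around the polygon. The pair forms exactly one of eight configurations. (i) If $t_1,t_2$ share two vertices $u,v$: "taco" if their third vertices lie on the same side of the line $uv$, "mariposa" if on opposite sides. (ii) If they share exactly one vertex $v$: read the remaining four vertices in cyclic order starting just after $v$; "bat" if the pattern is $t_1t_1t_2t_2$ or $t_2t_2t_1t_1$, "nested" if it is $t_1t_2t_2t_1$ or $t_2t_1t_1t_2$, "crossing" if it is $t_1t_2t_1t_2$ or $t_2t_1t_2t_1$. (iii) If they share no vertex, the cyclic sequence of the six labels is, up to rotation, reflection and exchanging the roles of $t_1,t_2$, one of: "ears" $AAABBB$, "swords" $AABABB$, "david" $ABABAB$. For a set $X$ of configurations, $\mathrm{ex}(n,X)$ is the maximum size of a family of triangles on $P$ in which no two triangles form a configuration belonging to $X$ (this depends only on $n$ and $X$). -}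

module Defs where

open import Data.Nat using (ℕ; zero; suc; _≤_; _*_; _^_)
open import Data.Fin using (Fin; toℕ) renaming (_<_ to _<ᶠ_; _≟_ to _≟ᶠ_)
open import Data.List using (List; []; _∷_; _++_; drop; take; reverse; map; length; mapMaybe; allFin)
open import Data.List.Relation.Unary.AllPairs using (AllPairs)
open import Data.Maybe using (Maybe; just; nothing)
open import Data.Product using (_×_; _,_; ∃; ∃-syntax)
open import Data.Sum using (_⊎_)
open import Relation.Nullary using (¬_; yes; no; Dec)
open import Relation.Binary.PropositionalEquality using (_≡_; _≢_)

-- The n points in convex position are identified with Fin n, numbered
-- in their cyclic order around the polygon.

record Tri (n : ℕ) : Set where
  constructor tri
  field
    a b c : Fin n
    a<b : a <ᶠ b
    b<c : b <ᶠ c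
open Tri public

verts : ∀ {n} → Tri n → Fin n × Fin n × Fin n
verts t = a t , b t , c t

Distinct : ∀ {n} → Tri n → Tri n → Set
Distinct t₁ t₂ = verts t₁ ≢ verts t₂

_∈?_ : ∀ {n} (p : Fin n) (t : Tri n) → Dec (p ≡ a t ⊎ p ≡ b t ⊎ p ≡ c t)
p ∈? t with p ≟ᶠ a t | p ≟ᶠ b t | p ≟ᶠ c t
... | yes e | _ | _ = yes (Data.Sum.inj₁ e)
... | no _ | yes e | _ = yes (Data.Sum.inj₂ (Data.Sum.inj₁ e))
... | no _ | no _ | yes e = yes (Data.Sum.inj₂ (Data.Sum.inj₂ e))
... | no x | no y | no z = no λ { (Data.Sum.inj₁ e) → x e
                               ; (Data.Sum.inj₂ (Data.Sum.inj₁ e)) → y e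
                               ; (Data.Sum.inj₂ (Data.Sum.inj₂ e)) → z e }

-- Labels: A = only in t₁, B = only in t₂, AB = in both.
data Lab : Set where
  A B AB : Lab

label : ∀ {n} → Tri n → Tri n → Fin n → Maybe Lab
label t₁ t₂ p with p ∈? t₁ | p ∈? t₂
... | yes _ | yes _ = just AB
... | yes _ | no _  = just A
... | no _  | yes _ = just B
... | no _  | no _  = nothing

word : ∀ {n} → Tri n → Tri n → List Lab
word {n} t₁ t₂ = mapMaybe (label t₁ t₂) (allFin n)

rotate : ℕ → List Lab → List Lab
rotate k w = drop k w ++ take k w

swapLab : Lab → Lab
swapLab A = B
swapLab B = A
swapLab AB = AB

Matches : List Lab → List Lab → Set
Matches w p = ∃[ k ] (w ≡ rotate k p ⊎ w ≡ rotate k (reverse p)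
                      ⊎ w ≡ rotate k (map swapLab p)
                      ⊎ w ≡ rotate k (map swapLab (reverse p)))

Ears : ∀ {n} → Tri n → Tri n → Set
Ears t₁ t₂ = Matches (word t₁ t₂) (A ∷ A ∷ A ∷ B ∷ B ∷ B ∷ [])

Bat : ∀ {n} → Tri n → Tri n → Set
Bat t₁ t₂ = Matches (word t₁ t₂) (AB ∷ A ∷ A ∷ B ∷ B ∷ [])

-- mariposa: two shared vertices u,v; the third vertices are on opposite
-- sides of uv, i.e. (convex position) separated by u and v in cyclic order
Mariposa : ∀ {n} → Tri n → Tri n → Set
Mariposa t₁ t₂ = Matches (word t₁ t₂) (AB ∷ A ∷ AB ∷ B ∷ [])

Forbidden : ∀ {n} → Tri n → Tri n → Set
Forbidden t₁ t₂ = Ears t₁ t₂ ⊎ Bat t₁ t₂ ⊎ Mariposa t₁ t₂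

GoodFamily : ∀ {n} → List (Tri n) → Set
GoodFamily F = AllPairs (λ t₁ t₂ → Distinct t₁ t₂ × ¬ Forbidden t₁ t₂) F

module Submission where

-- Number the points of the polygon 0,…,n-1 and cut them into three
-- consecutive arcs X = [0,l₁), Y = [l₁,l₁+l₂) and Z = [l₁+l₂,n).  A triangle
-- is transversal if it has one vertex in each arc.  For two transversal
-- triangles t, t' the cyclic word of t ∪ t' is a concatenation of three
-- blocks, one per arc: "AB" when t and t' share their vertex in that arc,
-- and "A B" or "B A" otherwise.  A finite check of the 27 block patterns
-- shows that such a word is an ears, bat or mariposa word only if all three
-- blocks are shared, i.e. only if t = t'.  So the l₁·l₂·l₃ transversal
-- triangles form a good family, and arcs of sizes m, m, m + (n mod 3) with
-- m = ⌊n/3⌋ give at least n³/216 triangles once n ≥ 3.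

open import Defs
open import Data.Bool using (Bool; true; false)
open import Data.Bool.Properties using (∨-identityʳ)
open import Data.Fin using (Fin; toℕ; fromℕ; fromℕ<; _↑ˡ_; _↑ʳ_)
open import Data.Fin.Properties
  using (toℕ-injective; toℕ<n; toℕ-fromℕ; toℕ-fromℕ<; toℕ-↑ˡ; toℕ-↑ʳ; ↑ˡ-injective; ↑ʳ-injective; any?)
open import Data.List
  using (List; []; _∷_; _++_; map; length; mapMaybe; allFin; reverse; tabulate; cartesianProduct; cartesianProductWith)
open import Data.List.Properties
  using (≡-dec; mapMaybe-cong; mapMaybe-map; mapMaybe-++; map-tabulate; length-tabulate; length-map;
         length-++; length-reverse; drop-all; take-all)
import Data.List.Relation.Unary.AllPairs as AllPairs
import Data.List.Relation.Unary.AllPairs.Properties as AllPairs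
open import Data.List.Relation.Unary.Unique.Propositional.Properties using (cartesianProduct⁺; allFin⁺)
open import Data.Maybe using (Maybe; just; nothing; maybe′)
open import Data.Nat
  using (ℕ; zero; suc; _+_; _*_; _^_; _≤_; _<_; _≟_; _≤?_; _/_; _%_; z≤n; s≤s; z<s)
open import Data.Nat.DivMod using (m≡m%n+[m/n]*n; m%n<n; m≥n⇒m/n>0)
open import Data.Nat.Properties
open import Data.Nat.Solver using (module +-*-Solver)
open import Data.Product using (_×_; _,_; ∃; ∃-syntax; proj₁; proj₂)
open import Data.Sum using (_⊎_; [_,_]′)
import Data.Sum as Sum
open import Function using (_∘_; id; mk⇔)
open import Relation.Nullary using (¬_; Dec; yes; no; does; ¬?; contradiction)
open import Relation.Nullary.Decidable using (map′; dec-true; dec-false; does-⇔; from-yes; _⊎-dec_; _×-dec_)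
open import Relation.Binary.PropositionalEquality

ForbiddenWord : List Lab → Set
ForbiddenWord w = Matches w (A ∷ A ∷ A ∷ B ∷ B ∷ B ∷ [])
                ⊎ Matches w (AB ∷ A ∷ A ∷ B ∷ B ∷ [])
                ⊎ Matches w (AB ∷ A ∷ AB ∷ B ∷ [])

_≟ˡ_ : (x y : Lab) → Dec (x ≡ y)
A  ≟ˡ A  = yes refl
A  ≟ˡ B  = no λ ()
A  ≟ˡ AB = no λ ()
B  ≟ˡ A  = no λ ()
B  ≟ˡ B  = yes refl
B  ≟ˡ AB = no λ ()
AB ≟ˡ A  = no λ ()
AB ≟ˡ B  = no λ ()
AB ≟ˡ AB = yes refl

MatchesAt : List Lab → List Lab → ℕ → Set
MatchesAt w p k = w ≡ rotate k p ⊎ w ≡ rotate k (reverse p)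
                ⊎ w ≡ rotate k (map swapLab p) ⊎ w ≡ rotate k (map swapLab (reverse p))

matchesAt? : ∀ w p k → Dec (MatchesAt w p k)
matchesAt? w p k = w ≟w rotate k p ⊎-dec w ≟w rotate k (reverse p)
                 ⊎-dec w ≟w rotate k (map swapLab p) ⊎-dec w ≟w rotate k (map swapLab (reverse p))
  where
    _≟w_ : (u v : List Lab) → Dec (u ≡ v)
    _≟w_ = ≡-dec _≟ˡ_

rotate-long : ∀ q {k} → length q ≤ k → rotate k q ≡ q
rotate-long q {k} h rewrite drop-all k q h | take-all k q h = refl

matchesAt-saturate : ∀ w p {k} → length p ≤ k → MatchesAt w p k → MatchesAt w p (length p)
matchesAt-saturate w p {k} h = Sum.map (resat p refl) (Sum.map (resat (reverse p) (length-reverse p))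
    (Sum.map (resat (map swapLab p) (length-map swapLab p))
             (resat (map swapLab (reverse p)) (trans (length-map swapLab (reverse p)) (length-reverse p)))))
  where
    resat : ∀ q → length q ≡ length p → w ≡ rotate k q → w ≡ rotate (length p) q
    resat q e w≡ = trans w≡ (trans (rotate-long q (subst (_≤ k) (sym e) h))
                                   (sym (rotate-long q (≤-reflexive e))))

-- Matching is decidable: it suffices to try the rotations 0,…,length p.
matches? : ∀ w p → Dec (Matches w p)
matches? w p = map′ (λ (k , m) → toℕ k , m) bounded (any? λ (k : Fin (suc (length p))) → matchesAt? w p (toℕ k))
  where
    bounded : Matches w p → ∃ λ (k : Fin (suc (length p))) → MatchesAt w p (toℕ k)
    bounded (k , m) with k ≤? length p
    ... | yes k≤ = fromℕ< (s≤s k≤) , subst (MatchesAt w p) (sym (toℕ-fromℕ< (s≤s k≤))) m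
    ... | no k≰  = fromℕ (length p) , subst (MatchesAt w p) (sym (toℕ-fromℕ (length p)))
                                        (matchesAt-saturate w p (≰⇒≥ k≰) m)

forbiddenWord? : ∀ w → Dec (ForbiddenWord w)
forbiddenWord? w = matches? w _ ⊎-dec matches? w _ ⊎-dec matches? w _

labelFrom : Bool → Bool → Maybe Lab
labelFrom true  true  = just AB
labelFrom true  false = just A
labelFrom false true  = just B
labelFrom false false = nothing

label≡labelFrom : ∀ {n} (t₁ t₂ : Tri n) p → label t₁ t₂ p ≡ labelFrom (does (p ∈? t₁)) (does (p ∈? t₂))
label≡labelFrom t₁ t₂ p with p ∈? t₁ | p ∈? t₂
... | yes _ | yes _ = refl
... | yes _ | no _  = refl
... | no _  | yes _ = refl
... | no _  | no _  = refl

α β γ : ∀ {n} → Tri n → ℕ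
α t = toℕ (a t)
β t = toℕ (b t)
γ t = toℕ (c t)

vertex? : ∀ {n} (x : ℕ) (t : Tri n) → Dec (x ≡ α t ⊎ x ≡ β t ⊎ x ≡ γ t)
vertex? x t = x ≟ α t ⊎-dec x ≟ β t ⊎-dec x ≟ γ t

∈?≡vertex? : ∀ {n} (p : Fin n) (t : Tri n) → does (p ∈? t) ≡ does (vertex? (toℕ p) t)
∈?≡vertex? p t = does-⇔ (mk⇔ (Sum.map (cong toℕ) (Sum.map (cong toℕ) (cong toℕ)))
                               (Sum.map toℕ-injective (Sum.map toℕ-injective toℕ-injective)))
                          (p ∈? t) (vertex? (toℕ p) t)

vertex?-first : ∀ {n x} (t : Tri n) → x ≢ β t → x ≢ γ t → does (vertex? x t) ≡ does (x ≟ α t)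
vertex?-first {x = x} t x≢β x≢γ rewrite dec-false (x ≟ β t) x≢β | dec-false (x ≟ γ t) x≢γ = ∨-identityʳ _

vertex?-second : ∀ {n x} (t : Tri n) → x ≢ α t → x ≢ γ t → does (vertex? x t) ≡ does (x ≟ β t)
vertex?-second {x = x} t x≢α x≢γ rewrite dec-false (x ≟ α t) x≢α | dec-false (x ≟ γ t) x≢γ = ∨-identityʳ _

vertex?-third : ∀ {n x} (t : Tri n) → x ≢ α t → x ≢ β t → does (vertex? x t) ≡ does (x ≟ γ t)
vertex?-third {x = x} t x≢α x≢β rewrite dec-false (x ≟ α t) x≢α | dec-false (x ≟ β t) x≢β = refl

labelAt : ∀ {n} → Tri n → Tri n → ℕ → Maybe Lab
labelAt t₁ t₂ x = labelFrom (does (vertex? x t₁)) (does (vertex? x t₂))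

interval : ℕ → ℕ → List ℕ
interval s zero    = []
interval s (suc L) = s ∷ interval (suc s) L

tabulate≡interval : ∀ L s (h : Fin L → ℕ) → (∀ i → h i ≡ s + toℕ i) → tabulate h ≡ interval s L
tabulate≡interval zero    s h e = refl
tabulate≡interval (suc L) s h e =
  cong₂ _∷_ (trans (e Fin.zero) (+-identityʳ s))
            (tabulate≡interval L (suc s) (h ∘ Fin.suc) (λ i → trans (e (Fin.suc i)) (+-suc s (toℕ i))))
  where import Data.Fin as Fin

interval-++ : ∀ L₁ L₂ s → interval s (L₁ + L₂) ≡ interval s L₁ ++ interval (s + L₁) L₂
interval-++ zero      L₂ s = cong (λ z → interval z L₂) (sym (+-identityʳ s))
interval-++ (suc L₁) L₂ s = cong (s ∷_) (trans (interval-++ L₁ L₂ (suc s))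
                                              (cong (λ z → interval (suc s) L₁ ++ interval z L₂) (sym (+-suc s L₁))))

word≡labelAt : ∀ {n} (t₁ t₂ : Tri n) → word t₁ t₂ ≡ mapMaybe (labelAt t₁ t₂) (interval 0 n)
word≡labelAt {n} t₁ t₂ = begin
    mapMaybe (label t₁ t₂) (allFin n)
  ≡⟨ mapMaybe-cong (λ p → trans (label≡labelFrom t₁ t₂ p) (cong₂ labelFrom (∈?≡vertex? p t₁) (∈?≡vertex? p t₂))) (allFin n) ⟩
    mapMaybe (labelAt t₁ t₂ ∘ toℕ) (allFin n)
  ≡⟨ sym (mapMaybe-map (labelAt t₁ t₂) toℕ (allFin n)) ⟩
    mapMaybe (labelAt t₁ t₂) (map toℕ (allFin n))
  ≡⟨ cong (mapMaybe (labelAt t₁ t₂)) (trans (map-tabulate id toℕ) (tabulate≡interval n 0 toℕ (λ _ → refl))) ⟩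
    mapMaybe (labelAt t₁ t₂) (interval 0 n) ∎
  where open ≡-Reasoning

-- How two single points p (of t₁) and q (of t₂) inside one arc are read.
data Block : Set where
  firstBefore shared secondBefore : Block

blockWord : Block → List Lab
blockWord firstBefore  = A ∷ B ∷ []
blockWord shared       = AB ∷ []
blockWord secondBefore = B ∷ A ∷ []

pairLabel : ℕ → ℕ → ℕ → Maybe Lab
pairLabel p q x = labelFrom (does (x ≟ p)) (does (x ≟ q))

pairLabel-off : ∀ {p q x} → x ≢ p → x ≢ q → pairLabel p q x ≡ nothing
pairLabel-off {p} {q} {x} x≢p x≢q rewrite dec-false (x ≟ p) x≢p | dec-false (x ≟ q) x≢q = refl

pairLabel-shared : ∀ p → pairLabel p p p ≡ just AB
pairLabel-shared p rewrite dec-true (p ≟ p) refl = refl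

pairLabel-first : ∀ {p q} → p ≢ q → pairLabel p q p ≡ just A
pairLabel-first {p} {q} p≢q rewrite dec-true (p ≟ p) refl | dec-false (p ≟ q) p≢q = refl

pairLabel-second : ∀ {p q} → p ≢ q → pairLabel p q q ≡ just B
pairLabel-second {p} {q} p≢q rewrite dec-false (q ≟ p) (p≢q ∘ sym) | dec-true (q ≟ q) refl = refl

mapMaybe-just : ∀ {X : Set} (f : X → Maybe Lab) {l} x xs → f x ≡ just l → mapMaybe f (x ∷ xs) ≡ l ∷ mapMaybe f xs
mapMaybe-just f x xs e rewrite e = refl

mapMaybe-nothing : ∀ {X : Set} (f : X → Maybe Lab) x xs → f x ≡ nothing → mapMaybe f (x ∷ xs) ≡ mapMaybe f xs
mapMaybe-nothing f x xs e rewrite e = refl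

silent : ∀ (f : ℕ → Maybe Lab) L s → (∀ x → s ≤ x → f x ≡ nothing) → mapMaybe f (interval s L) ≡ []
silent f zero    s h = refl
silent f (suc L) s h = trans (mapMaybe-nothing f s (interval (suc s) L) (h s ≤-refl))
                             (silent f L (suc s) (λ x s<x → h x (<⇒≤ s<x)))

single : ∀ (f : ℕ → Maybe Lab) {l} L s q → s ≤ q → q < s + L →
         (∀ x → s ≤ x → x ≢ q → f x ≡ nothing) → f q ≡ just l → mapMaybe f (interval s L) ≡ l ∷ []
single f zero    s q s≤q q< off on = contradiction (subst (q <_) (+-identityʳ s) q<) (≤⇒≯ s≤q)
single f (suc L) s q s≤q q< off on with s ≟ q
... | yes refl = trans (mapMaybe-just f s (interval (suc s) L) on)
                       (cong (_ ∷_) (silent f L (suc s) (λ x s<x → off x (<⇒≤ s<x) (>⇒≢ s<x))))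
... | no s≢q   = trans (mapMaybe-nothing f s (interval (suc s) L) (off s ≤-refl s≢q))
                       (single f L (suc s) q (≤∧≢⇒< s≤q s≢q) (subst (q <_) (+-suc s L) q<)
                               (λ x s<x → off x (<⇒≤ s<x)) on)

BlockOf : ℕ → ℕ → List Lab → Set
BlockOf p q w = ∃[ c ] (w ≡ blockWord c × (c ≡ shared → p ≡ q))

block : ∀ L s p q → s ≤ p → p < s + L → s ≤ q → q < s + L → BlockOf p q (mapMaybe (pairLabel p q) (interval s L))
block zero    s p q s≤p p< _ _ = contradiction (subst (p <_) (+-identityʳ s) p<) (≤⇒≯ s≤p)
block (suc L) s p q s≤p p< s≤q q< with s ≟ p | s ≟ q
... | yes refl | yes refl =
  shared , trans (mapMaybe-just f s tail (pairLabel-shared s))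
                 (cong (AB ∷_) (silent f L (suc s) (λ x s<x → pairLabel-off (>⇒≢ s<x) (>⇒≢ s<x)))) , λ _ → refl
  where
    f : ℕ → Maybe Lab
    f = pairLabel s s
    tail : List ℕ
    tail = interval (suc s) L
... | yes refl | no s≢q =
  firstBefore , trans (mapMaybe-just f s tail (pairLabel-first s≢q))
                      (cong (A ∷_) (single f L (suc s) q (≤∧≢⇒< s≤q s≢q) (subst (q <_) (+-suc s L) q<)
                                           (λ x s<x x≢q → pairLabel-off (>⇒≢ s<x) x≢q) (pairLabel-second s≢q))) , λ ()
  where
    f : ℕ → Maybe Lab
    f = pairLabel s q
    tail : List ℕ
    tail = interval (suc s) L
... | no s≢p | yes refl =
  secondBefore , trans (mapMaybe-just f s tail (pairLabel-second (s≢p ∘ sym)))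
                       (cong (B ∷_) (single f L (suc s) p (≤∧≢⇒< s≤p s≢p) (subst (p <_) (+-suc s L) p<)
                                            (λ x s<x x≢p → pairLabel-off x≢p (>⇒≢ s<x)) (pairLabel-first (s≢p ∘ sym)))) , λ ()
  where
    f : ℕ → Maybe Lab
    f = pairLabel p s
    tail : List ℕ
    tail = interval (suc s) L
... | no s≢p | no s≢q =
  subst (BlockOf p q) (sym (mapMaybe-nothing (pairLabel p q) s (interval (suc s) L) (pairLabel-off s≢p s≢q)))
        (block L (suc s) p q (≤∧≢⇒< s≤p s≢p) (subst (p <_) (+-suc s L) p<)
                             (≤∧≢⇒< s≤q s≢q) (subst (q <_) (+-suc s L) q<))

shared? : (c : Block) → Dec (c ≡ shared)
shared? firstBefore  = no λ ()
shared? shared       = yes refl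
shared? secondBefore = no λ ()

∀-block? : {P : Block → Set} → (∀ c → Dec (P c)) → Dec (∀ c → P c)
∀-block? P? with P? firstBefore | P? shared | P? secondBefore
... | yes p | yes q | yes r = yes λ { firstBefore → p ; shared → q ; secondBefore → r }
... | no ¬p | _     | _     = no λ h → ¬p (h firstBefore)
... | yes _ | no ¬q | _     = no λ h → ¬q (h shared)
... | yes _ | yes _ | no ¬r = no λ h → ¬r (h secondBefore)

blocksWord : Block → Block → Block → List Lab
blocksWord c₁ c₂ c₃ = (blockWord c₁ ++ blockWord c₂) ++ blockWord c₃

AllShared : Block → Block → Block → Set
AllShared c₁ c₂ c₃ = c₁ ≡ shared × c₂ ≡ shared × c₃ ≡ shared

-- The finite check: a word made of three blocks is an ears, bat or mariposa
-- word only if all three blocks are shared.  Verified by evaluating the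
-- decision procedure on all 27 block patterns.
blocks-safe : ∀ c₁ c₂ c₃ → ForbiddenWord (blocksWord c₁ c₂ c₃) → AllShared c₁ c₂ c₃
blocks-safe c₁ c₂ c₃ forb = [ (λ ¬forb → contradiction forb ¬forb) , id ]′ (check c₁ c₂ c₃)
  where
    check : ∀ c₁ c₂ c₃ → ¬ ForbiddenWord (blocksWord c₁ c₂ c₃) ⊎ AllShared c₁ c₂ c₃
    check = from-yes (∀-block? λ c₁ → ∀-block? λ c₂ → ∀-block? λ c₃ →
                        ¬? (forbiddenWord? (blocksWord c₁ c₂ c₃)) ⊎-dec shared? c₁ ×-dec shared? c₂ ×-dec shared? c₃)

record Transversal (l₁ l₂ : ℕ) {n} (t : Tri n) : Set where
  field
    a-in-X    : α t < l₁
    b-after-X : l₁ ≤ β t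
    b-in-Y    : β t < l₁ + l₂
    c-in-Z    : l₁ + l₂ ≤ γ t
open Transversal

on-X : ∀ {l₁ l₂ n x} {t : Tri n} → Transversal l₁ l₂ t → x < l₁ → does (vertex? x t) ≡ does (x ≟ α t)
on-X {t = t} τ x<l₁ = vertex?-first t (<⇒≢ (<-≤-trans x<l₁ (b-after-X τ)))
                                      (<⇒≢ (<-≤-trans x<l₁ (≤-trans (b-after-X τ) (<⇒≤ (b<c t)))))

on-Y : ∀ {l₁ l₂ n x} {t : Tri n} → Transversal l₁ l₂ t → l₁ ≤ x → x < l₁ + l₂ → does (vertex? x t) ≡ does (x ≟ β t)
on-Y {t = t} τ l₁≤x x< = vertex?-second t (>⇒≢ (<-≤-trans (a-in-X τ) l₁≤x)) (<⇒≢ (<-≤-trans x< (c-in-Z τ)))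

on-Z : ∀ {l₁ l₂ n x} {t : Tri n} → Transversal l₁ l₂ t → l₁ + l₂ ≤ x → does (vertex? x t) ≡ does (x ≟ γ t)
on-Z {l₁} {l₂} {t = t} τ ≤x = vertex?-third t (>⇒≢ (<-≤-trans (a-in-X τ) (≤-trans (m≤m+n l₁ l₂) ≤x)))
                                              (>⇒≢ (<-≤-trans (b-in-Y τ) ≤x))

mapMaybe-cong-interval : ∀ (f g : ℕ → Maybe Lab) L s → (∀ x → s ≤ x → x < s + L → f x ≡ g x) →
                         mapMaybe f (interval s L) ≡ mapMaybe g (interval s L)
mapMaybe-cong-interval f g zero    s agree = refl
mapMaybe-cong-interval f g (suc L) s agree =
  cong₂ (maybe′ _∷_ id) (agree s ≤-refl (m<m+n s z<s))
        (mapMaybe-cong-interval f g L (suc s) (λ x s<x x< → agree x (<⇒≤ s<x) (subst (x <_) (sym (+-suc s L)) x<)))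

arc-block : ∀ (f : ℕ → Maybe Lab) L s p q → (∀ x → s ≤ x → x < s + L → f x ≡ pairLabel p q x) →
            s ≤ p → p < s + L → s ≤ q → q < s + L → BlockOf p q (mapMaybe f (interval s L))
arc-block f L s p q agree s≤p p< s≤q q< =
  subst (BlockOf p q) (sym (mapMaybe-cong-interval f (pairLabel p q) L s agree)) (block L s p q s≤p p< s≤q q<)

word-blocks : ∀ {l₁ l₂ l₃} {t t' : Tri (l₁ + l₂ + l₃)} → Transversal l₁ l₂ t → Transversal l₁ l₂ t' →
  ∃[ c₁ ] ∃[ c₂ ] ∃[ c₃ ] (word t t' ≡ blocksWord c₁ c₂ c₃
    × (c₁ ≡ shared → α t ≡ α t') × (c₂ ≡ shared → β t ≡ β t') × (c₃ ≡ shared → γ t ≡ γ t'))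
word-blocks {l₁} {l₂} {l₃} {t} {t'} τ τ'
  with arc-block (labelAt t t') l₁ 0 (α t) (α t') (λ x _ x< → cong₂ labelFrom (on-X τ x<) (on-X τ' x<))
                 z≤n (a-in-X τ) z≤n (a-in-X τ')
     | arc-block (labelAt t t') l₂ l₁ (β t) (β t') (λ x l₁≤x x< → cong₂ labelFrom (on-Y τ l₁≤x x<) (on-Y τ' l₁≤x x<))
                 (b-after-X τ) (b-in-Y τ) (b-after-X τ') (b-in-Y τ')
     | arc-block (labelAt t t') l₃ (l₁ + l₂) (γ t) (γ t') (λ x ≤x _ → cong₂ labelFrom (on-Z τ ≤x) (on-Z τ' ≤x))
                 (c-in-Z τ) (toℕ<n (c t)) (c-in-Z τ') (toℕ<n (c t'))
... | c₁ , w₁ , s₁ | c₂ , w₂ , s₂ | c₃ , w₃ , s₃ = c₁ , c₂ , c₃ , word≡blocks , s₁ , s₂ , s₃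
  where
    open ≡-Reasoning
    f : ℕ → Maybe Lab
    f = labelAt t t'
    I₁ I₂ I₃ : List ℕ
    I₁ = interval 0 l₁
    I₂ = interval l₁ l₂
    I₃ = interval (l₁ + l₂) l₃
    word≡blocks : word t t' ≡ blocksWord c₁ c₂ c₃
    word≡blocks = begin
        word t t'
      ≡⟨ word≡labelAt t t' ⟩
        mapMaybe f (interval 0 (l₁ + l₂ + l₃))
      ≡⟨ cong (mapMaybe f) (trans (interval-++ (l₁ + l₂) l₃ 0) (cong (_++ I₃) (interval-++ l₁ l₂ 0))) ⟩
        mapMaybe f ((I₁ ++ I₂) ++ I₃)
      ≡⟨ trans (mapMaybe-++ f (I₁ ++ I₂) I₃) (cong (_++ mapMaybe f I₃) (mapMaybe-++ f I₁ I₂)) ⟩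
        (mapMaybe f I₁ ++ mapMaybe f I₂) ++ mapMaybe f I₃
      ≡⟨ cong₂ _++_ (cong₂ _++_ w₁ w₂) w₃ ⟩
        blocksWord c₁ c₂ c₃ ∎

transversal-safe : ∀ {l₁ l₂ l₃} {t t' : Tri (l₁ + l₂ + l₃)} → Transversal l₁ l₂ t → Transversal l₁ l₂ t' →
                   Distinct t t' → ¬ Forbidden t t'
transversal-safe τ τ' t≢t' forb =
  let (c₁ , c₂ , c₃ , w≡ , s₁ , s₂ , s₃) = word-blocks τ τ'
      (e₁ , e₂ , e₃) = blocks-safe c₁ c₂ c₃ (subst ForbiddenWord w≡ forb)
  in t≢t' (cong₂ _,_ (toℕ-injective (s₁ e₁)) (cong₂ _,_ (toℕ-injective (s₂ e₂)) (toℕ-injective (s₃ e₃))))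

length-cartesianProductWith : ∀ {X Y Z : Set} (f : X → Y → Z) xs ys →
                              length (cartesianProductWith f xs ys) ≡ length xs * length ys
length-cartesianProductWith f []       ys = refl
length-cartesianProductWith f (x ∷ xs) ys =
  trans (length-++ (map (f x) ys)) (cong₂ _+_ (length-map (f x) ys) (length-cartesianProductWith f xs ys))

module Transversals (l₁ l₂ l₃ : ℕ) where

  vertexX : Fin l₁ → Fin (l₁ + l₂ + l₃)
  vertexX i = (i ↑ˡ l₂) ↑ˡ l₃

  vertexY : Fin l₂ → Fin (l₁ + l₂ + l₃)
  vertexY j = (l₁ ↑ʳ j) ↑ˡ l₃

  vertexZ : Fin l₃ → Fin (l₁ + l₂ + l₃)
  vertexZ k = (l₁ + l₂) ↑ʳ k

  toℕ-vertexX : ∀ i → toℕ (vertexX i) ≡ toℕ i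
  toℕ-vertexX i = trans (toℕ-↑ˡ (i ↑ˡ l₂) l₃) (toℕ-↑ˡ i l₂)

  toℕ-vertexY : ∀ j → toℕ (vertexY j) ≡ l₁ + toℕ j
  toℕ-vertexY j = trans (toℕ-↑ˡ (l₁ ↑ʳ j) l₃) (toℕ-↑ʳ l₁ j)

  toℕ-vertexZ : ∀ k → toℕ (vertexZ k) ≡ l₁ + l₂ + toℕ k
  toℕ-vertexZ k = toℕ-↑ʳ (l₁ + l₂) k

  Index : Set
  Index = Fin l₁ × Fin l₂ × Fin l₃

  transversalTri : Index → Tri (l₁ + l₂ + l₃)
  transversalTri (i , j , k) = tri (vertexX i) (vertexY j) (vertexZ k) X<Y Y<Z
    where
      X<Y : toℕ (vertexX i) < toℕ (vertexY j)
      X<Y rewrite toℕ-vertexX i | toℕ-vertexY j = <-≤-trans (toℕ<n i) (m≤m+n l₁ (toℕ j))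
      Y<Z : toℕ (vertexY j) < toℕ (vertexZ k)
      Y<Z rewrite toℕ-vertexY j | toℕ-vertexZ k = <-≤-trans (+-monoʳ-< l₁ (toℕ<n j)) (m≤m+n (l₁ + l₂) (toℕ k))

  transversalTri-transversal : ∀ u → Transversal l₁ l₂ (transversalTri u)
  transversalTri-transversal (i , j , k) = record
    { a-in-X    = subst (_< l₁) (sym (toℕ-vertexX i)) (toℕ<n i)
    ; b-after-X = subst (l₁ ≤_) (sym (toℕ-vertexY j)) (m≤m+n l₁ (toℕ j))
    ; b-in-Y    = subst (_< l₁ + l₂) (sym (toℕ-vertexY j)) (+-monoʳ-< l₁ (toℕ<n j))
    ; c-in-Z    = subst (l₁ + l₂ ≤_) (sym (toℕ-vertexZ k)) (m≤m+n (l₁ + l₂) (toℕ k))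
    }

  transversalTri-injective : ∀ u v → verts (transversalTri u) ≡ verts (transversalTri v) → u ≡ v
  transversalTri-injective (i , j , k) (i' , j' , k') e =
    cong₂ _,_ (↑ˡ-injective l₂ i i' (↑ˡ-injective l₃ _ _ (cong proj₁ e)))
              (cong₂ _,_ (↑ʳ-injective l₁ j j' (↑ˡ-injective l₃ _ _ (cong (proj₁ ∘ proj₂) e)))
                         (↑ʳ-injective (l₁ + l₂) k k' (cong (proj₂ ∘ proj₂) e)))

  indices : List Index
  indices = cartesianProduct (allFin l₁) (cartesianProduct (allFin l₂) (allFin l₃))

  transversals : List (Tri (l₁ + l₂ + l₃))
  transversals = map transversalTri indices

  transversals-good : GoodFamily transversals
  transversals-good = AllPairs.map⁺ (AllPairs.map good-pair
    (cartesianProduct⁺ (allFin⁺ l₁) (cartesianProduct⁺ (allFin⁺ l₂) (allFin⁺ l₃))))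
    where
      good-pair : ∀ {u v} → u ≢ v → Distinct (transversalTri u) (transversalTri v)
                                    × ¬ Forbidden (transversalTri u) (transversalTri v)
      good-pair {u} {v} u≢v = distinct , transversal-safe (transversalTri-transversal u) (transversalTri-transversal v) distinct
        where
          distinct : Distinct (transversalTri u) (transversalTri v)
          distinct = u≢v ∘ transversalTri-injective u v

  length-transversals : length transversals ≡ l₁ * (l₂ * l₃)
  length-transversals = begin
      length transversals
    ≡⟨ length-map transversalTri indices ⟩
      length indices
    ≡⟨ length-cartesianProductWith _,_ (allFin l₁) _ ⟩
      length (allFin l₁) * length (cartesianProduct (allFin l₂) (allFin l₃))
    ≡⟨ cong₂ _*_ (length-allFin l₁) (length-cartesianProductWith _,_ (allFin l₂) (allFin l₃)) ⟩
      l₁ * (length (allFin l₂) * length (allFin l₃))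
    ≡⟨ cong (l₁ *_) (cong₂ _*_ (length-allFin l₂) (length-allFin l₃)) ⟩
      l₁ * (l₂ * l₃) ∎
    where
      open ≡-Reasoning
      length-allFin : ∀ k → length (allFin k) ≡ k
      length-allFin k = length-tabulate {n = k} id

open +-*-Solver

cube-bound : ∀ {n m k} → n ≤ 6 * m → m ≤ k → n ^ 3 ≤ 216 * (m * (m * k))
cube-bound {n} {m} {k} n≤6m m≤k = begin
    n ^ 3
  ≤⟨ *-mono-≤ n≤6m (*-mono-≤ n≤6m (*-monoˡ-≤ 1 n≤6k)) ⟩
    6 * m * (6 * m * (6 * k * 1))
  ≡⟨ solve 2 (λ m k → con 6 :* m :* (con 6 :* m :* (con 6 :* k :* con 1)) := con 216 :* (m :* (m :* k))) refl m k ⟩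
    216 * (m * (m * k)) ∎
  where
    open ≤-Reasoning
    n≤6k : n ≤ 6 * k
    n≤6k = ≤-trans n≤6m (*-monoʳ-≤ 6 m≤k)

thirds : ∀ n → n ≡ n / 3 + n / 3 + (n % 3 + n / 3)
thirds n = trans (m≡m%n+[m/n]*n n 3) (solve 2 (λ r m → r :+ m :* con 3 := m :+ m :+ (r :+ m)) refl (n % 3) (n / 3))

third-bound : ∀ n → 3 ≤ n → n ≤ 6 * (n / 3)
third-bound n 3≤n = begin
    n
  ≡⟨ m≡m%n+[m/n]*n n 3 ⟩
    n % 3 + n / 3 * 3
  ≤⟨ +-monoˡ-≤ (n / 3 * 3) (≤-trans (<⇒≤ (m%n<n n 3)) (*-monoˡ-≤ 3 (m≥n⇒m/n>0 3≤n))) ⟩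
    n / 3 * 3 + n / 3 * 3
  ≡⟨ solve 1 (λ m → m :* con 3 :+ m :* con 3 := con 6 :* m) refl (n / 3) ⟩
    6 * (n / 3) ∎
  where open ≤-Reasoning

theorem2 : ∃[ d ] ∃[ N ] ((n : ℕ) → N ≤ n →
    ∃[ F ] (GoodFamily {n} F × n ^ 3 ≤ suc d * length F))
theorem2 = 215 , 3 , large
  where
    large : (n : ℕ) → 3 ≤ n → ∃[ F ] (GoodFamily {n} F × n ^ 3 ≤ 216 * length F)
    large n 3≤n = subst Goal (sym (thirds n)) (transversals , transversals-good , bound)
      where
        m : ℕ
        m = n / 3
        open Transversals m m (n % 3 + m)
        Goal : ℕ → Set
        Goal k = ∃[ F ] (GoodFamily {k} F × k ^ 3 ≤ 216 * length F)
        bound : (m + m + (n % 3 + m)) ^ 3 ≤ 216 * length transversals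
        bound = subst₂ (λ k L → k ^ 3 ≤ 216 * L) (thirds n) (sym length-transversals)
                       (cube-bound (third-bound n 3≤n) (m≤n+m m (n % 3)))
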